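{- Let $w$ be a binary word over $\{0,1\}$. For each size $i$ with $3\le i\le|w|+3$, there exists a factor $u$ of $w$ of length $i-3$ such that $\mathrm{RC}(u)$ is a fully leafed caterpillar subsequence of $\mathrm{RC}(w)$.
   Context: A caterpillar sequence is a finite sequence $S=(s_1,\dots,s_k)$, $k\ge1$, of non-negative integers with $s_1,s_k\ge1$, and $s_1\ge2$ if $k=1$; size $|S|=k+\sum_j s_j$, number of leaves $\ell(S)=\sum_j s_j$. Let $f(S)=(s_1)$ if $k=1$ and $f(S)=(s_1+1,s_2+2,\dots,s_{k-1}+2,s_k+1)$ if $k>1$; $S'\preceq S$ (caterpillar subsequence) means $S'$ has length $k'\le k$ and there is $i\in\{0,\dots,k-k'\}$ with $f(S')[j]\le f(S)[j+i]$ for $1\le j\le k'$. Let $L_S(i)$ be the maximum number of degree-1 vertices of an induced subtree with $i$ vertices of the caterpillar graph of $S$ (a path $v_1,\dots,v_k$ with $s_j$ pendant leaves at $v_j$); for $i\ge3$ it equals $\max\{\ell(S'):S'\preceq S,|S'|=i\}$. A caterpillar subsequence $S'\preceq S$ with $|S'|=i$ is fully leafed if $\ell(S')=L_S(i)$. The reading caterpillar sequence: $\mathrm{RC}(\varepsilon)=(2)$ and, if $\mathrm{RC}(u)=(r_1,\dots,r_k)$, $\mathrm{RC}(u0)=(r_1,\dots,r_{k-1},r_k-1,1)$, $\mathrm{RC}(u1)=(r_1,\dots,r_{k-1},r_k+1)$. -}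

module Defs where

open import Data.Nat using (ℕ; zero; suc; _+_; _∸_; _≤_)
open import Data.Bool using (Bool; true; false)
open import Data.List using (List; []; _∷_; _++_; length; take; drop; foldl)
open import Data.Nat.ListAction using (sum)
open import Data.List.Relation.Binary.Pointwise using (Pointwise)
open import Data.Product using (_×_; ∃; ∃-syntax; Σ-syntax)
open import Relation.Binary.PropositionalEquality using (_≡_)

lastOr0 : List ℕ → ℕ
lastOr0 []           = 0
lastOr0 (x ∷ [])     = x
lastOr0 (x ∷ y ∷ ys) = lastOr0 (y ∷ ys)

data IsCaterpillar : List ℕ → Set where
  single : ∀ {s} → 2 ≤ s → IsCaterpillar (s ∷ [])
  multi  : ∀ {s t ts} → 1 ≤ s → 1 ≤ lastOr0 (t ∷ ts) → IsCaterpillar (s ∷ t ∷ ts)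

leaves : List ℕ → ℕ
leaves S = sum S

size : List ℕ → ℕ
size S = length S + sum S

fTail : List ℕ → List ℕ
fTail []           = []
fTail (y ∷ [])     = suc y ∷ []
fTail (y ∷ z ∷ zs) = (2 + y) ∷ fTail (z ∷ zs)

f : List ℕ → List ℕ
f []           = []
f (x ∷ [])     = x ∷ []
f (x ∷ y ∷ ys) = suc x ∷ fTail (y ∷ ys)

_⪯_ : List ℕ → List ℕ → Set
S′ ⪯ S = ∃[ i ] ((i + length S′ ≤ length S) ×
                 Pointwise _≤_ (f S′) (take (length S′) (drop i (f S))))

-- S' is a fully leafed caterpillar subsequence of S of size i:
-- S' is a caterpillar subsequence of S with |S'| = i and ℓ(S') = L_S(i),
-- where L_S(i) = max { ℓ(S'') : S'' ⪯ S, |S''| = i } (valid for i ≥ 3).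
FullyLeafed : List ℕ → ℕ → List ℕ → Set
FullyLeafed S i S′ =
  IsCaterpillar S′ × S′ ⪯ S × size S′ ≡ i ×
  (∀ S″ → IsCaterpillar S″ → S″ ⪯ S → size S″ ≡ i → leaves S″ ≤ leaves S′)

-- Binary words: false = 0, true = 1.
-- modify the last entry r_k of a sequence by a function returning a list
modLast : (ℕ → List ℕ) → List ℕ → List ℕ
modLast g []           = []
modLast g (x ∷ [])     = g x
modLast g (x ∷ y ∷ ys) = x ∷ modLast g (y ∷ ys)

rcStep : List ℕ → Bool → List ℕ
rcStep r false = modLast (λ x → (x ∸ 1) ∷ 1 ∷ []) r
rcStep r true  = modLast (λ x → suc x ∷ []) r

RC : List Bool → List ℕ
RC w = foldl rcStep (2 ∷ []) w

Factor : List Bool → List Bool → Set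
Factor u w = ∃[ p ] ∃[ s ] (w ≡ p ++ u ++ s)

-- Record w by its runs (r₁, …, r_k): the numbers of 1s before the first 0, between
-- consecutive 0s, and after the last 0. Then RC(w) is (r₁, …, r_k) with its first and
-- its last entry each raised by one, so f(RC(w)) = (r₁ + 2, …, r_k + 2), and S ⪯ RC(w) says that f(S) is
-- dominated entrywise by a window of consecutive entries of this list. Reading w from
-- the start of that window, each letter costs one unit of f(S): a 1 lowers the current
-- entry, a 0 moves on to the next entry and uses up at most 2 of it. Since
-- Σ f(S) = |S| + size(S) - 2, a sequence S of size j + 3 pays for a factor v of w of
-- length j with at most |S| runs. Among sequences of a fixed size, fewer entries means
-- more leaves; so if u is a length-j factor of w with the fewest runs, no S beats RC(u).
module Submission where

open import Defs
open import Data.Nat using (ℕ; _+_; _≤_)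
open import Data.Bool using (Bool)
open import Data.List using (List; length)
open import Data.Product using (_×_; ∃-syntax)
open import Relation.Binary.PropositionalEquality using (_≡_)

open import Data.Nat using (zero; suc; _*_; _∸_; _<_; z≤n; s≤s; _≤?_)
open import Data.Nat.Properties
open import Data.Nat.Tactic.RingSolver using (solve-∀)
open import Data.Bool using (true; false)
open import Data.List using ([]; _∷_; _++_; take; drop; foldl; map)
open import Data.List.Properties using (length-take; take++drop≡id; length-++-≤ˡ; length-++-≤ʳ; ∷-injectiveʳ)
open import Data.Nat.ListAction using (sum)
open import Data.List.Extrema.Core ≤-totalOrder using (⊓ᴸ; ⊓ᴸ-sel; ⊓ᴸ-presᵒ-≤v)
open import Data.List.Relation.Binary.Pointwise using (Pointwise; []; _∷_)
open import Data.List.Relation.Binary.Prefix.Heterogeneous using (Prefix; []; _∷_)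
import Data.List.Relation.Binary.Prefix.Heterogeneous.Properties as Prefix
open import Data.List.Relation.Binary.Infix.Heterogeneous using (Infix; here; there) renaming (map to Infix-map)
import Data.List.Relation.Binary.Infix.Heterogeneous.Properties as Infix
open import Data.Product using (_,_; proj₁; proj₂)
open import Data.Sum using (_⊎_; inj₁; inj₂)
open import Data.Empty using (⊥; ⊥-elim)
open import Function using (_∘_)
open import Level using (Level)
open import Relation.Binary.Core using (REL)
open import Relation.Nullary using (yes; no)
open import Relation.Binary.PropositionalEquality using (refl; sym; trans; cong; cong₂; subst; subst₂; module ≡-Reasoning)

leadingOnes : List Bool → ℕ
leadingOnes []          = 0
leadingOnes (true ∷ w)  = suc (leadingOnes w)
leadingOnes (false ∷ w) = 0

-- Defined so that runs w is always visibly a cons.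
mutual
  runs : List Bool → List ℕ
  runs w = leadingOnes w ∷ laterRuns w

  laterRuns : List Bool → List ℕ
  laterRuns []          = []
  laterRuns (true ∷ w)  = laterRuns w
  laterRuns (false ∷ w) = runs w

size-runs : ∀ w → size (runs w) ≡ suc (length w)
size-runs []          = refl
size-runs (true ∷ w)  = cong suc (trans (+-suc (length (laterRuns w)) _) (size-runs w))
size-runs (false ∷ w) = cong suc (size-runs w)

runs-prefix : ∀ u s → Prefix _≤_ (runs u) (runs (u ++ s))
runs-prefix []          s = z≤n ∷ []
runs-prefix (true ∷ u)  s with runs-prefix u s
... | r ∷ rs = s≤s r ∷ rs
runs-prefix (false ∷ u) s = ≤-refl ∷ runs-prefix u s

Infix-raiseHead : ∀ {zs x y ys} → x ≤ y → Infix _≤_ zs (x ∷ ys) → Infix _≤_ zs (y ∷ ys)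
Infix-raiseHead x≤y (here [])        = here []
Infix-raiseHead x≤y (here (z≤x ∷ p)) = here (≤-trans z≤x x≤y ∷ p)
Infix-raiseHead x≤y (there p)        = there p

runs-infix : ∀ p u s → Infix _≤_ (runs u) (runs (p ++ u ++ s))
runs-infix []          u s = here (runs-prefix u s)
runs-infix (true ∷ p)  u s = Infix-raiseHead (n≤1+n _) (runs-infix p u s)
runs-infix (false ∷ p) u s = there (runs-infix p u s)

bumpHead : List ℕ → List ℕ
bumpHead []       = []
bumpHead (x ∷ xs) = suc x ∷ xs

bumpLast : List ℕ → List ℕ
bumpLast []           = []
bumpLast (x ∷ [])     = suc x ∷ []
bumpLast (x ∷ y ∷ ys) = x ∷ bumpLast (y ∷ ys)

bumpHead-bumpLast : ∀ x xs → bumpHead (bumpLast (x ∷ xs)) ≡ bumpLast (suc x ∷ xs)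
bumpHead-bumpLast x []       = refl
bumpHead-bumpLast x (y ∷ ys) = refl

length-bumpLast : ∀ xs → length (bumpLast xs) ≡ length xs
length-bumpLast []           = refl
length-bumpLast (x ∷ [])     = refl
length-bumpLast (x ∷ y ∷ ys) = cong suc (length-bumpLast (y ∷ ys))

sum-bumpLast : ∀ x xs → sum (bumpLast (x ∷ xs)) ≡ suc (sum (x ∷ xs))
sum-bumpLast x []       = refl
sum-bumpLast x (y ∷ ys) = trans (cong (x +_) (sum-bumpLast y ys)) (+-suc x _)

1≤lastOr0-bumpLast : ∀ x xs → 1 ≤ lastOr0 (bumpLast (x ∷ xs))
1≤lastOr0-bumpLast x []           = s≤s z≤n
1≤lastOr0-bumpLast x (y ∷ [])     = s≤s z≤n
1≤lastOr0-bumpLast x (y ∷ z ∷ zs) = 1≤lastOr0-bumpLast y (z ∷ zs)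

fTail-bumpLast : ∀ x xs → fTail (bumpLast (x ∷ xs)) ≡ map (2 +_) (x ∷ xs)
fTail-bumpLast x []           = refl
fTail-bumpLast x (y ∷ [])     = refl
fTail-bumpLast x (y ∷ z ∷ zs) = cong (2 + x ∷_) (fTail-bumpLast y (z ∷ zs))

f-bumpLast : ∀ x xs → f (bumpLast (suc x ∷ xs)) ≡ map (2 +_) (x ∷ xs)
f-bumpLast x []           = refl
f-bumpLast x (y ∷ [])     = refl
f-bumpLast x (y ∷ z ∷ zs) = cong (2 + x ∷_) (fTail-bumpLast y (z ∷ zs))

bumpLast-isCaterpillar : ∀ x xs → IsCaterpillar (bumpLast (suc x ∷ xs))
bumpLast-isCaterpillar x []           = single (s≤s (s≤s z≤n))
bumpLast-isCaterpillar x (y ∷ [])     = multi (s≤s z≤n) (s≤s z≤n)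
bumpLast-isCaterpillar x (y ∷ z ∷ zs) = multi (s≤s z≤n) (1≤lastOr0-bumpLast y (z ∷ zs))

foldl-rcStep-∷ : ∀ x y ys w → foldl rcStep (x ∷ y ∷ ys) w ≡ x ∷ foldl rcStep (y ∷ ys) w
foldl-rcStep-∷ x y ys       []          = refl
foldl-rcStep-∷ x y []       (true ∷ w)  = foldl-rcStep-∷ x (suc y) [] w
foldl-rcStep-∷ x y []       (false ∷ w) = foldl-rcStep-∷ x (y ∸ 1) (1 ∷ []) w
foldl-rcStep-∷ x y (z ∷ zs) (true ∷ w)  = foldl-rcStep-∷ x y (rcStep (z ∷ zs) true) w
foldl-rcStep-∷ x y (z ∷ zs) (false ∷ w) = foldl-rcStep-∷ x y (rcStep (z ∷ zs) false) w

foldl-rcStep-suc : ∀ x w → foldl rcStep (2 + x ∷ []) w ≡ bumpHead (foldl rcStep (1 + x ∷ []) w)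
foldl-rcStep-suc x []          = refl
foldl-rcStep-suc x (true ∷ w)  = foldl-rcStep-suc (suc x) w
foldl-rcStep-suc x (false ∷ w) =
  trans (foldl-rcStep-∷ (suc x) 1 [] w) (cong bumpHead (sym (foldl-rcStep-∷ x 1 [] w)))

foldl-rcStep-1 : ∀ w → foldl rcStep (1 ∷ []) w ≡ bumpLast (runs w)
foldl-rcStep-1 []          = refl
foldl-rcStep-1 (true ∷ w)  = begin
  foldl rcStep (2 ∷ []) w                ≡⟨ foldl-rcStep-suc 0 w ⟩
  bumpHead (foldl rcStep (1 ∷ []) w)     ≡⟨ cong bumpHead (foldl-rcStep-1 w) ⟩
  bumpHead (bumpLast (runs w))           ≡⟨ bumpHead-bumpLast (leadingOnes w) (laterRuns w) ⟩
  bumpLast (runs (true ∷ w))             ∎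
  where open ≡-Reasoning
foldl-rcStep-1 (false ∷ w) = trans (foldl-rcStep-∷ 0 1 [] w) (cong (0 ∷_) (foldl-rcStep-1 w))

-- RC(w) is the reading from (1) of the word 1w.
RC≡bumpLast-bumpHead-runs : ∀ w → RC w ≡ bumpLast (bumpHead (runs w))
RC≡bumpLast-bumpHead-runs w = foldl-rcStep-1 (true ∷ w)

f-RC : ∀ w → f (RC w) ≡ map (2 +_) (runs w)
f-RC w = trans (cong f (RC≡bumpLast-bumpHead-runs w)) (f-bumpLast (leadingOnes w) (laterRuns w))

length-RC : ∀ w → length (RC w) ≡ length (runs w)
length-RC w = trans (cong length (RC≡bumpLast-bumpHead-runs w)) (length-bumpLast (bumpHead (runs w)))

leaves-RC : ∀ w → leaves (RC w) ≡ 2 + leaves (runs w)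
leaves-RC w = trans (cong sum (RC≡bumpLast-bumpHead-runs w)) (sum-bumpLast (suc (leadingOnes w)) (laterRuns w))

size-RC : ∀ w → size (RC w) ≡ length w + 3
size-RC w = begin
  length (RC w) + leaves (RC w)             ≡⟨ cong₂ _+_ (length-RC w) (leaves-RC w) ⟩
  length (runs w) + (2 + leaves (runs w))   ≡⟨ shift (length (runs w)) (leaves (runs w)) ⟩
  2 + size (runs w)                         ≡⟨ cong (2 +_) (size-runs w) ⟩
  3 + length w                              ≡⟨ +-comm 3 (length w) ⟩
  length w + 3                              ∎
  where
  open ≡-Reasoning
  shift : ∀ a b → a + (2 + b) ≡ 2 + (a + b)
  shift = solve-∀

RC-isCaterpillar : ∀ w → IsCaterpillar (RC w)
RC-isCaterpillar w = subst IsCaterpillar (sym (RC≡bumpLast-bumpHead-runs w))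
  (bumpLast-isCaterpillar (leadingOnes w) (laterRuns w))

-- Caterpillar subsequences as windows

length-fTail : ∀ xs → length (fTail xs) ≡ length xs
length-fTail []           = refl
length-fTail (x ∷ [])     = refl
length-fTail (x ∷ y ∷ ys) = cong suc (length-fTail (y ∷ ys))

length-f : ∀ S → length (f S) ≡ length S
length-f []           = refl
length-f (x ∷ [])     = refl
length-f (x ∷ y ∷ ys) = cong suc (length-fTail (y ∷ ys))

sum-fTail : ∀ x xs → sum (fTail (x ∷ xs)) ≡ suc (2 * length xs + sum (x ∷ xs))
sum-fTail x []       = refl
sum-fTail x (y ∷ ys) = begin
  2 + x + sum (fTail (y ∷ ys))                  ≡⟨ cong (2 + x +_) (sum-fTail y ys) ⟩
  2 + x + suc (2 * length ys + sum (y ∷ ys))    ≡⟨ regroup x (length ys) (sum (y ∷ ys)) ⟩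
  suc (2 * length (y ∷ ys) + sum (x ∷ y ∷ ys))  ∎
  where
  open ≡-Reasoning
  regroup : ∀ a k b → 2 + a + suc (2 * k + b) ≡ suc (2 * suc k + (a + b))
  regroup = solve-∀

sum-f : ∀ s ss → sum (f (s ∷ ss)) + 2 ≡ length (s ∷ ss) + size (s ∷ ss)
sum-f s []       = regroup s
  where
  regroup : ∀ a → a + 0 + 2 ≡ 1 + (1 + (a + 0))
  regroup = solve-∀
sum-f s (t ∷ ts) = begin
  suc s + sum (fTail (t ∷ ts)) + 2                  ≡⟨ cong (λ m → suc s + m + 2) (sum-fTail t ts) ⟩
  suc s + suc (2 * length ts + sum (t ∷ ts)) + 2    ≡⟨ regroup s (length ts) (sum (t ∷ ts)) ⟩
  length (s ∷ t ∷ ts) + size (s ∷ t ∷ ts)           ∎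
  where
  open ≡-Reasoning
  regroup : ∀ a k b → suc a + suc (2 * k + b) + 2 ≡ suc (suc k) + (suc (suc k) + (a + b))
  regroup = solve-∀

module _ {a b r : Level} {A : Set a} {B : Set b} {R : REL A B r} where

  Prefix⇒Pointwise-take : ∀ {xs ys} → Prefix R xs ys → Pointwise R xs (take (length xs) ys)
  Prefix⇒Pointwise-take []       = []
  Prefix⇒Pointwise-take (r ∷ rs) = r ∷ Prefix⇒Pointwise-take rs

  Pointwise-take⇒Prefix : ∀ xs ys → Pointwise R xs (take (length xs) ys) → Prefix R xs ys
  Pointwise-take⇒Prefix []       ys       []       = []
  Pointwise-take⇒Prefix (x ∷ xs) (y ∷ ys) (r ∷ rs) = r ∷ Pointwise-take⇒Prefix xs ys rs

  Infix⇒window : ∀ {xs ys} → Infix R xs ys →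
    ∃[ i ] (i + length xs ≤ length ys × Pointwise R xs (take (length xs) (drop i ys)))
  Infix⇒window (here p)  = 0 , Prefix.length-mono p , Prefix⇒Pointwise-take p
  Infix⇒window (there q) with Infix⇒window q
  ... | i , bound , pw = suc i , s≤s bound , pw

  window⇒Infix : ∀ {xs} i ys → Pointwise R xs (take (length xs) (drop i ys)) → Infix R xs ys
  window⇒Infix zero    ys       pw = here (Pointwise-take⇒Prefix _ ys pw)
  window⇒Infix (suc i) []       pw = here (Pointwise-take⇒Prefix _ [] pw)
  window⇒Infix (suc i) (y ∷ ys) pw = there (window⇒Infix i ys pw)

⪯⇒Infix : ∀ {S′ S} → S′ ⪯ S → Infix _≤_ (f S′) (f S)
⪯⇒Infix {S′} {S} (i , _ , pw) = window⇒Infix i (f S)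
  (subst (λ k → Pointwise _≤_ (f S′) (take k (drop i (f S)))) (sym (length-f S′)) pw)

Infix⇒⪯ : ∀ {S′ S} → Infix _≤_ (f S′) (f S) → S′ ⪯ S
Infix⇒⪯ {S′} {S} p with Infix⇒window p
... | i , bound , pw rewrite length-f S′ | length-f S = i , bound , pw

factor-there : ∀ {v w} b → Factor v w → Factor v (b ∷ w)
factor-there b (p , s , e) = b ∷ p , s , cong (b ∷_) e

take-factor : ∀ n w → Factor (take n w) w
take-factor n w = [] , drop n w , sym (take++drop≡id n w)

length-take≡ : ∀ {a} {A : Set a} {n} (w : List A) → n ≤ length w → length (take n w) ≡ n
length-take≡ {n = n} w n≤ = trans (length-take n w) (m≤n⇒m⊓n≡m n≤)

factor-length : ∀ {v w} → Factor v w → length v ≤ length w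
factor-length {v} (p , s , refl) = ≤-trans (length-++-≤ˡ v) (length-++-≤ʳ (v ++ s) {p})

take-length-++ : ∀ {a} {A : Set a} (xs ys : List A) → take (length xs) (xs ++ ys) ≡ xs
take-length-++ []       ys = refl
take-length-++ (x ∷ xs) ys = cong (x ∷_) (take-length-++ xs ys)

factor-∷⁻ : ∀ {v b w} → Factor v (b ∷ w) → take (length v) (b ∷ w) ≡ v ⊎ Factor v w
factor-∷⁻ {v} ([] , s , e)  = inj₁ (trans (cong (take (length v)) e) (take-length-++ v s))
factor-∷⁻ ((_ ∷ p) , s , e) = inj₂ (p , s , ∷-injectiveʳ e)

factor⇒RC⪯ : ∀ {u w} → Factor u w → RC u ⪯ RC w
factor⇒RC⪯ {u} {w} (p , s , refl) = Infix⇒⪯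
  (subst₂ (Infix _≤_) (sym (f-RC u)) (sym (f-RC w))
    (Infix.map⁺ (2 +_) (2 +_) (Infix-map (s≤s ∘ s≤s) (runs-infix p u s))))

minimal-factor : (μ : List Bool → ℕ) (n : ℕ) (w : List Bool) → n ≤ length w →
  ∃[ u ] (Factor u w × length u ≡ n × (∀ v → Factor v w → length v ≡ n → μ u ≤ μ v))
minimal-factor μ n [] z≤n = [] , ([] , [] , refl) , refl , λ { [] _ _ → ≤-refl ; (_ ∷ _) _ () }
minimal-factor μ n (b ∷ w) n≤ with n ≤? length w
... | no n≰w = take n (b ∷ w) , take-factor n (b ∷ w) , length-take≡ (b ∷ w) n≤ , least
  where
  least : ∀ v → Factor v (b ∷ w) → length v ≡ n → μ (take n (b ∷ w)) ≤ μ v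
  least v fv refl with factor-∷⁻ fv
  ... | inj₁ prefix = ≤-reflexive (cong μ prefix)
  ... | inj₂ fv′    = ⊥-elim (n≰w (factor-length fv′))
... | yes n≤w with minimal-factor μ n w n≤w
...   | u , fu , lu , least-u = m , proj₁ m-ok , proj₂ m-ok , least
  where
  c m : List Bool
  c = take n (b ∷ w)
  m = ⊓ᴸ μ c u
  m-ok : Factor m (b ∷ w) × length m ≡ n
  m-ok with ⊓ᴸ-sel μ c u
  ... | inj₁ m≡c = subst (λ z → Factor z (b ∷ w) × length z ≡ n) (sym m≡c)
                     (take-factor n (b ∷ w) , length-take≡ (b ∷ w) n≤)
  ... | inj₂ m≡u = subst (λ z → Factor z (b ∷ w) × length z ≡ n) (sym m≡u) (factor-there b fu , lu)
  least : ∀ v → Factor v (b ∷ w) → length v ≡ n → μ m ≤ μ v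
  least v fv refl with factor-∷⁻ fv
  ... | inj₁ prefix = ⊓ᴸ-presᵒ-≤v μ c u (inj₁ (≤-reflexive (cong μ prefix)))
  ... | inj₂ fv′    = ⊓ᴸ-presᵒ-≤v μ c u (inj₂ (least-u v fv′ refl))

-- Short factors inside a window

-- xs affords n when, after paying one unit per entry, more than n units are left.
Affords : ℕ → List ℕ → Set
Affords n xs = n + length xs < sum xs

¬Affords-[] : ∀ {n} → Affords n [] → ⊥
¬Affords-[] ()

Affords-after-1 : ∀ {n x xs} → Affords (suc n) (x ∷ xs) → Affords n (x ∸ 1 ∷ xs)
Affords-after-1 {x = zero}  h = <⇒≤ h
Affords-after-1 {x = suc x} h = ≤-pred h

Affords-after-0 : ∀ {n x xs} → x ≤ 2 → Affords (suc n) (x ∷ xs) → Affords n xs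
Affords-after-0 {n} {x} {xs} x≤2 h = +-cancelˡ-< 2 (n + length xs) (sum xs) (begin-strict
  2 + (n + length xs)     ≡⟨ cong suc (sym (+-suc n (length xs))) ⟩
  suc n + length (x ∷ xs) <⟨ h ⟩
  x + sum xs              ≤⟨ +-monoˡ-≤ (sum xs) x≤2 ⟩
  2 + sum xs              ∎)
  where open ≤-Reasoning

-- Read w from the start of the window: a 1 lowers the current entry, a 0 drops it.
prefix-factor : ∀ n w xs → Prefix _≤_ xs (map (2 +_) (runs w)) → Affords n xs →
  n ≤ length w × length (runs (take n w)) ≤ length xs
prefix-factor zero    w           []       _         h = ⊥-elim (¬Affords-[] h)
prefix-factor zero    w           (x ∷ xs) _         _ = z≤n , s≤s z≤n
prefix-factor (suc n) []          (x ∷ []) (x≤2 ∷ []) h = ⊥-elim (¬Affords-[] (Affords-after-0 {xs = []} x≤2 h))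
prefix-factor (suc n) (true ∷ w)  (x ∷ xs) (x≤ ∷ p)  h
  with prefix-factor n w (x ∸ 1 ∷ xs) (∸-monoˡ-≤ 1 x≤ ∷ p) (Affords-after-1 {xs = xs} h)
... | n≤w , bound = s≤s n≤w , bound
prefix-factor (suc n) (false ∷ w) (x ∷ xs) (x≤2 ∷ p) h
  with prefix-factor n w xs p (Affords-after-0 {xs = xs} x≤2 h)
... | n≤w , bound = s≤s n≤w , s≤s bound

infix-factor : ∀ n w xs → Infix _≤_ xs (map (2 +_) (runs w)) → Affords n xs →
  ∃[ v ] (Factor v w × length v ≡ n × length (runs v) ≤ length xs)
infix-factor n w xs (here p) h with prefix-factor n w xs p h
... | n≤w , bound = take n w , take-factor n w , length-take≡ w n≤w , bound
infix-factor n [] xs (there (here [])) h = ⊥-elim (¬Affords-[] h)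
infix-factor n (true ∷ w) xs (there q) h with infix-factor n w xs (there q) h
... | v , fv , lv , bound = v , factor-there true fv , lv , bound
infix-factor n (false ∷ w) xs (there q) h with infix-factor n w xs q h
... | v , fv , lv , bound = v , factor-there false fv , lv , bound

short-factor : ∀ S w j → IsCaterpillar S → S ⪯ RC w → size S ≡ 3 + j →
  ∃[ v ] (Factor v w × length v ≡ j × length (RC v) ≤ length S)
short-factor [] w j ()
short-factor S@(s ∷ ss) w j _ S⪯ sz with infix-factor j w (f S) window (≤-reflexive (sym budget))
  where
  window : Infix _≤_ (f S) (map (2 +_) (runs w))
  window = subst (Infix _≤_ (f S)) (f-RC w) (⪯⇒Infix S⪯)
  regroup : ∀ k j → k + (3 + j) ≡ suc (j + k) + 2
  regroup = solve-∀
  budget : sum (f S) ≡ suc (j + length (f S))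
  budget = +-cancelʳ-≡ 2 _ _ (begin
    sum (f S) + 2                 ≡⟨ sum-f s ss ⟩
    length S + size S             ≡⟨ cong (length S +_) sz ⟩
    length S + (3 + j)            ≡⟨ regroup (length S) j ⟩
    suc (j + length S) + 2        ≡⟨ cong (λ k → suc (j + k) + 2) (sym (length-f S)) ⟩
    suc (j + length (f S)) + 2    ∎)
    where open ≡-Reasoning
... | v , fv , lv , bound = v , fv , lv ,
  subst₂ _≤_ (sym (length-RC v)) (length-f S) bound

leaves-antitone : ∀ S T → size S ≡ size T → length T ≤ length S → leaves S ≤ leaves T
leaves-antitone S T eq le = +-cancelˡ-≤ (length T) (leaves S) (leaves T) (begin
  length T + leaves S  ≤⟨ +-monoˡ-≤ (leaves S) le ⟩
  size S               ≡⟨ eq ⟩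
  size T               ∎)
  where open ≤-Reasoning

corollary1 : (w : List Bool) (i : ℕ) → 3 ≤ i → i ≤ length w + 3 →
    ∃[ u ] (Factor u w × length u + 3 ≡ i × FullyLeafed (RC w) i (RC u))
corollary1 w (suc (suc (suc j))) (s≤s (s≤s (s≤s _))) i≤
  with minimal-factor (length ∘ RC) j w (+-cancelˡ-≤ 3 j (length w) (subst (3 + j ≤_) (+-comm (length w) 3) i≤))
... | u , fu , lu , fewest = u , fu , length≡ , RC-isCaterpillar u , factor⇒RC⪯ fu , size≡ , most-leaves
  where
  length≡ : length u + 3 ≡ 3 + j
  length≡ = trans (cong (_+ 3) lu) (+-comm j 3)
  size≡ : size (RC u) ≡ 3 + j
  size≡ = trans (size-RC u) length≡
  most-leaves : ∀ S → IsCaterpillar S → S ⪯ RC w → size S ≡ 3 + j → leaves S ≤ leaves (RC u)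
  most-leaves S cat S⪯ sz with short-factor S w j cat S⪯ sz
  ... | v , fv , lv , short = leaves-antitone S (RC u) (trans sz (sym size≡)) (≤-trans (fewest v fv lv) short)
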